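{- Let $\Sigma$ be an alphabet, $k,s\in\mathbb{N}$ with $k\ge s$, and $A,B\subseteq\Sigma^*$. If there is a word $w\in A\cap B$, then D has a winning strategy in the game $\mathrm{GRES}(k,s,A,B)$ (equivalently, from any position $(k,s,A,B)$ reached in any game $\mathrm{GRES}(k_0,s_0,A_0,B_0)$).
   Context: For a word $w$, $\mathrm{Sp}^n(w)=\{(w_1,\dots,w_n)\mid w_1\cdots w_n=w\}$, $\mathrm{Sp}(w)=\bigcup_n\mathrm{Sp}^n(w)$, $[n]=\{1,\dots,n\}$. The game $\mathrm{GRES}(k_0,s_0,A_0,B_0)$ ($k_0\ge s_0$) between players S and D has positions $(k,s,A,B)$ with $A,B\subseteq\Sigma^*$, $k,s\in\mathbb{N}$, $k\ge s$; it starts at $(k_0,s_0,A_0,B_0)$. At position $(k,s,A,B)$: if $k=0$, D wins. Otherwise S chooses one move: (a-move) S chooses $a\in\Sigma\cup\{\epsilon\}$; S wins if $A\subseteq\{a\}$ and $a\notin B$, otherwise D wins. ($\emptyset$-move) S wins if $A=\emptyset$, otherwise D wins. ($\cup$-move) S chooses $A_1,A_2\subseteq A$ with $A_1\cup A_2=A$ and naturals $k_1,k_2,s_1,s_2$ with $k_i\ge s_i$, $k_1+k_2+1=k$, $s_1+s_2=s$; D chooses $i\in\{1,2\}$; play continues from $(k_i,s_i,A_i,B)$. (cat-move) For every $w\in A$, S chooses $(w_1,w_2)\in\mathrm{Sp}^2(w)$; let $A_i=\{w_i\mid w\in A\}$. For every $v\in B$, S chooses $f_v:\mathrm{Sp}^2(v)\to\{1,2\}$;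 let $B_i=\{v_i\mid v\in B,(v_1,v_2)\in\mathrm{Sp}^2(v), f_v(v_1,v_2)=i\}$. S chooses $k_1,k_2,s_1,s_2$ as in the $\cup$-move; D chooses $i\in\{1,2\}$; play continues from $(k_i,s_i,A_i,B_i)$. ($*$-move, requiring $s\ge1$) If $\epsilon\in B$, D wins. Otherwise for every $w\in A\setminus\{\epsilon\}$ S chooses $n(w)>0$ and a split $(w_1,\dots,w_{n(w)})\in\mathrm{Sp}^{n(w)}(w)$ with all $w_i\ne\epsilon$; let $A'$ be the set of all these pieces. For every $v\in B$, S chooses $f_v$ assigning to each $(v_1,\dots,v_n)\in\mathrm{Sp}(v)$ an index in $[n]$; let $B'=\{v_i\mid v\in B,(v_1,\dots,v_n)\in\mathrm{Sp}(v),f_v(v_1,\dots,v_n)=i\}$. Play continues from $(k-1,s-1,A',B')$. ($\neg$-move) Play continues from $(k-1,s,B,A)$. -}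

module Defs where

open import Level using (Lift; lift) renaming (suc to lsuc; zero to lzero)
open import Data.Nat using (ℕ; zero; suc; _+_; _≤_)
open import Data.Bool using (Bool; true; false)
open import Data.Maybe using (Maybe; just; nothing)
open import Data.List using (List; []; _∷_; [_]; _++_; concat; length; lookup)
open import Data.List.Relation.Unary.All using (All)
open import Data.List.Membership.Propositional using (_∈_)
open import Data.Fin using (Fin)
open import Data.Product using (Σ; ∃; ∃-syntax; _×_; _,_; proj₁; proj₂)
open import Data.Sum using (_⊎_)
open import Data.Unit using (⊤)
open import Data.Empty using (⊥)
open import Relation.Nullary using (¬_)
open import Relation.Binary.PropositionalEquality using (_≡_)

Lang : Set → Set₁
Lang Alph = List Alph → Set

module _ {Alph : Set} where

  -- the word denoted by a ∈ Σ ∪ {ε}  (nothing = ε)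
  letter : Maybe Alph → List Alph
  letter (just a) = [ a ]
  letter nothing  = []

  Sp2 : List Alph → Set
  Sp2 w = Σ (List Alph × List Alph) (λ p → proj₁ p ++ proj₂ p ≡ w)

  NESplit : List Alph → Set
  NESplit w = Σ (List (List Alph)) (λ ws →
                 (concat ws ≡ w) × All (λ u → ¬ (u ≡ [])) ws × ¬ (ws ≡ []))

  -- Inductively (least fixed point; the game has depth ≤ k): D wins at
  -- k = 0, and at k > 0 D wins iff every move of S either is losing for S
  -- or leads (after D's choice, if any) to a position won by D.
  data DWins : ℕ → ℕ → Lang Alph → Lang Alph → Set₁ where
    dzero : ∀ {s A B} → DWins zero s A B
    dsuc : ∀ {k s A B} →
      -- a-move: S does not win, i.e. ¬ (A ⊆ {a} ∧ a ∉ B)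
      (∀ (a : Maybe Alph) →
         ¬ ((∀ w → A w → w ≡ letter a) × ¬ B (letter a))) →
      ¬ (∀ w → ¬ A w) →
      (∀ (A₁ A₂ : Lang Alph) →
         (∀ w → A₁ w → A w) → (∀ w → A₂ w → A w) →
         (∀ w → A w → A₁ w ⊎ A₂ w) →
         ∀ (k₁ k₂ s₁ s₂ : ℕ) → s₁ ≤ k₁ → s₂ ≤ k₂ →
         k₁ + k₂ ≡ k → s₁ + s₂ ≡ s →
         DWins k₁ s₁ A₁ B ⊎ DWins k₂ s₂ A₂ B) →
      -- cat-move: σ chooses a split of each word of A; f v v₁ v₂ chooses the
      -- index (true = 1, false = 2) for the split (v₁ , v₂) of v ∈ B
      (∀ (σ : (w : List Alph) → Sp2 w) (f : List Alph → List Alph → List Alph → Bool) →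
         ∀ (k₁ k₂ s₁ s₂ : ℕ) → s₁ ≤ k₁ → s₂ ≤ k₂ →
         k₁ + k₂ ≡ k → s₁ + s₂ ≡ s →
         DWins k₁ s₁ (λ x → ∃[ w ] (A w × proj₁ (proj₁ (σ w)) ≡ x))
                     (λ x → ∃[ v ] ∃[ v₂ ] (B v × x ++ v₂ ≡ v × f v x v₂ ≡ true))
         ⊎
         DWins k₂ s₂ (λ x → ∃[ w ] (A w × proj₂ (proj₁ (σ w)) ≡ x))
                     (λ x → ∃[ v ] ∃[ v₁ ] (B v × v₁ ++ x ≡ v × f v v₁ x ≡ false))) →
      -- *-move (only available when s = s′ + 1 ≥ 1; D wins if ε ∈ B).
      -- σ a w : split of the nonempty word a ∷ w into n > 0 nonempty pieces;
      -- f v u us : index in [n] (as Fin n, n = 1 + |us|) for the split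
      -- (u ∷ us) ∈ Sp(v)
      (∀ (s′ : ℕ) → s ≡ suc s′ → ¬ B [] →
       ∀ (σ : (a : Alph) (w : List Alph) → NESplit (a ∷ w))
         (f : (v u : List Alph) (us : List (List Alph)) → Fin (suc (length us))) →
       DWins k s′ (λ x → ∃[ a ] ∃[ w ] (A (a ∷ w) × x ∈ proj₁ (σ a w)))
                  (λ x → ∃[ v ] ∃[ u ] ∃[ us ]
                    (B v × concat (u ∷ us) ≡ v × lookup (u ∷ us) (f v u us) ≡ x))) →
      DWins k s B A →
      DWins (suc k) s A B

-- D keeps a word w ∈ A ∩ B as an invariant. It makes the a-move and the
-- ∅-move lose for S; under ∪ D goes to the side containing w, under cat to
-- the side f_w assigns to S's split of w, under * to the piece of S's split
-- of w selected by f_w (w ≠ ε since ε ∉ B), and ¬ swaps A and B. The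
-- ∪/cat budgets k₁, k₂ are at most k − 1, so well-founded induction on k
-- concludes.
module Submission where

open import Defs
open import Data.Nat using (ℕ; zero; suc; _+_; _≤_; _<_; s≤s)
open import Data.Nat.Properties using (m≤m+n; m≤n+m; ≤-refl)
open import Data.Nat.Induction using (<-wellFounded)
open import Data.Fin using (Fin)
open import Data.Maybe using (Maybe)
open import Data.List using (List; []; _∷_; _++_; concat; length; lookup)
open import Data.List.Membership.Propositional using (_∈_)
open import Data.List.Membership.Propositional.Properties using (∈-lookup)
open import Data.Product using (∃-syntax; _×_; _,_; proj₁; proj₂)
open import Data.Sum using (_⊎_; inj₁; inj₂)
import Data.Sum as Sum
open import Data.Bool using (Bool; true; false)
open import Data.Empty using (⊥-elim)
open import Induction.WellFounded using (Acc; acc)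
open import Relation.Nullary using (¬_)
open import Relation.Unary using (_≬_)
open import Relation.Unary.Properties using (≬-sym)
open import Relation.Binary.PropositionalEquality using (_≡_; refl; subst)

m+n≡k⇒m≤k : ∀ {m n k} → m + n ≡ k → m ≤ k
m+n≡k⇒m≤k {m} {n} m+n≡k = subst (m ≤_) m+n≡k (m≤m+n m n)

m+n≡k⇒n≤k : ∀ {m n k} → m + n ≡ k → n ≤ k
m+n≡k⇒n≤k {m} {n} m+n≡k = subst (n ≤_) m+n≡k (m≤n+m n m)

module _ {Σ : Set} where

  ¬-a-win : ∀ {A B : Lang Σ} (a : Maybe Σ) → A ≬ B →
            ¬ ((∀ w → A w → w ≡ letter a) × ¬ B (letter a))
  ¬-a-win {B = B} a (w , w∈A , w∈B) (A⊆a , a∉B) = a∉B (subst B (A⊆a w w∈A) w∈B)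

  ≬-cover : ∀ {A A₁ A₂ B : Lang Σ} → (∀ w → A w → A₁ w ⊎ A₂ w) →
            A ≬ B → A₁ ≬ B ⊎ A₂ ≬ B
  ≬-cover cover (w , w∈A , w∈B) = Sum.map (λ w∈A₁ → w , w∈A₁ , w∈B)
                                          (λ w∈A₂ → w , w∈A₂ , w∈B) (cover w w∈A)

  CatSplitter : Set
  CatSplitter = (w : List Σ) → Sp2 w

  CatAssigner : Set
  CatAssigner = List Σ → List Σ → List Σ → Bool

  LeftParts RightParts : Lang Σ → CatSplitter → Lang Σ
  LeftParts  A σ x = ∃[ w ] (A w × proj₁ (proj₁ (σ w)) ≡ x)
  RightParts A σ x = ∃[ w ] (A w × proj₂ (proj₁ (σ w)) ≡ x)

  LeftAssigned RightAssigned : Lang Σ → CatAssigner → Lang Σ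
  LeftAssigned  B f x = ∃[ v ] ∃[ v₂ ] (B v × x ++ v₂ ≡ v × f v x v₂ ≡ true)
  RightAssigned B f x = ∃[ v ] ∃[ v₁ ] (B v × v₁ ++ x ≡ v × f v v₁ x ≡ false)

  ≬-cat : ∀ {A B : Lang Σ} (σ : CatSplitter) (f : CatAssigner) → A ≬ B →
          LeftParts A σ ≬ LeftAssigned B f ⊎ RightParts A σ ≬ RightAssigned B f
  ≬-cat σ f (w , w∈A , w∈B) with f w (proj₁ (proj₁ (σ w))) (proj₂ (proj₁ (σ w))) in side
  ... | true  = inj₁ (_ , (w , w∈A , refl) , (w , _ , w∈B , proj₂ (σ w) , side))
  ... | false = inj₂ (_ , (w , w∈A , refl) , (w , _ , w∈B , proj₂ (σ w) , side))

  Splitter : Set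
  Splitter = (a : Σ) (w : List Σ) → NESplit (a ∷ w)

  Chooser : Set
  Chooser = (v u : List Σ) (us : List (List Σ)) → Fin (suc (length us))

  Pieces : Lang Σ → Splitter → Lang Σ
  Pieces A σ x = ∃[ a ] ∃[ w ] (A (a ∷ w) × x ∈ proj₁ (σ a w))

  ChosenPieces : Lang Σ → Chooser → Lang Σ
  ChosenPieces B f x = ∃[ v ] ∃[ u ] ∃[ us ]
    (B v × concat (u ∷ us) ≡ v × lookup (u ∷ us) (f v u us) ≡ x)

  chosen-piece : ∀ {w} (p : NESplit w)
                 (pick : (u : List Σ) (us : List (List Σ)) → Fin (suc (length us))) →
                 ∃[ x ] (x ∈ proj₁ p ×
                   ∃[ u ] ∃[ us ] (concat (u ∷ us) ≡ w × lookup (u ∷ us) (pick u us) ≡ x))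
  chosen-piece ([] , _ , _ , nonempty) pick = ⊥-elim (nonempty refl)
  chosen-piece (u ∷ us , concat≡w , _ , _) pick =
    lookup (u ∷ us) (pick u us) , ∈-lookup (pick u us) , u , us , concat≡w , refl

  Pieces-≬-ChosenPieces : ∀ {A B : Lang Σ} → ¬ B [] → A ≬ B →
                          (σ : Splitter) (f : Chooser) → Pieces A σ ≬ ChosenPieces B f
  Pieces-≬-ChosenPieces ε∉B ([] , _ , ε∈B) σ f = ⊥-elim (ε∉B ε∈B)
  Pieces-≬-ChosenPieces ε∉B (a ∷ w , aw∈A , aw∈B) σ f
    with chosen-piece (σ a w) (f (a ∷ w))
  ... | x , x∈σ , u , us , concat≡aw , chosen≡x =
    x , (a , w , aw∈A , x∈σ) , (a ∷ w , u , us , aw∈B , concat≡aw , chosen≡x)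

  ≬⇒DWins-acc : ∀ {k} → Acc _<_ k → ∀ s {A B : Lang Σ} → A ≬ B → DWins k s A B
  ≬⇒DWins-acc {zero}  _         s _ = dzero
  ≬⇒DWins-acc {suc k} (acc rec) s A≬B@(w , w∈A , _) =
    dsuc (λ a → ¬-a-win a A≬B)
         (λ A-empty → A-empty w w∈A)
         (λ _ _ _ _ cover k₁ k₂ s₁ s₂ _ _ k₁+k₂≡k _ →
            Sum.map (ih (m+n≡k⇒m≤k k₁+k₂≡k) s₁) (ih (m+n≡k⇒n≤k k₁+k₂≡k) s₂)
                    (≬-cover cover A≬B))
         (λ σ f k₁ k₂ s₁ s₂ _ _ k₁+k₂≡k _ →
            Sum.map (ih (m+n≡k⇒m≤k k₁+k₂≡k) s₁) (ih (m+n≡k⇒n≤k k₁+k₂≡k) s₂)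
                    (≬-cat σ f A≬B))
         (λ s′ _ ε∉B σ f → ih ≤-refl s′ (Pieces-≬-ChosenPieces ε∉B A≬B σ f))
         (ih ≤-refl s (≬-sym A≬B))
    where
    ih : ∀ {j} → j ≤ k → ∀ s {A B : Lang Σ} → A ≬ B → DWins j s A B
    ih j≤k = ≬⇒DWins-acc (rec (s≤s j≤k))

  ≬⇒DWins : ∀ k s {A B : Lang Σ} → A ≬ B → DWins k s A B
  ≬⇒DWins k = ≬⇒DWins-acc (<-wellFounded k)

lemma4 : {Σ : Set} (k s : ℕ) (A B : Lang Σ) → s ≤ k →
    ∃[ w ] (A w × B w) → DWins k s A B
lemma4 k s A B _ = ≬⇒DWins k s
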